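{- Let $\phi = C_1 \land \dots \land C_{m}$ be a 3-SAT formula (constructed as in the context). Then each $Z_i \in \mathcal Z(\phi)$ is a maximal common subsequence (MCS) of $\mathcal S(\phi)$.
   Context: A string $Y$ is a subsequence of a string $X$ if $Y$ can be obtained from $X$ by deleting some characters. A string $X$ is a common subsequence of a set of strings $\mathcal S$ if it is a subsequence of every string in $\mathcal S$, and it is a maximal common subsequence (MCS) of $\mathcal S$ if no proper supersequence of $X$ is a common subsequence of $\mathcal S$. For a string $R$ and integer $k$, $R^k$ denotes $R$ repeated $k$ times. Let $\phi = \bigwedge_{i=1}^m C_i$ be a 3-CNF formula on variables $x_1,\dots,x_v$, where $C_i = \ell^{(i)}_1 \lor \ell^{(i)}_2 \lor \ell^{(i)}_3$ with $\ell^{(i)}_1 \in \{x_\alpha, \bar{x}_\alpha\}$, $\ell^{(i)}_2 \in \{x_\beta, \bar{x}_\beta\}$, $\ell^{(i)}_3 \in \{x_\gamma, \bar{x}_\gamma\}$ for some $1 \le \alpha < \beta < \gamma \le v$. Assume no clause contains both $x_j$ and $\bar{x}_j$, and no variable appears in every clause. The alphabet is $\{x_1,\bar x_1,\dots,x_v,\bar x_v\}$ (each literal is a character). Let $R = x_{v}\bar{x}_{v} \dots x_1\bar{x}_1$. For each clause $C_i$ define $S_i = R^{\alpha-1} \ell^{(i)}_{1} R^{\beta - \alpha} \ell^{(i)}_{2} R^{\gamma - \beta} \ell^{(i)}_{3} R^{v-\gamma}$, and define $S_0 = x_1\bar{x}_1 \ldots x_{v}\bar{x}_{v}$. Let $\mathcal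 S(\phi) = \{S_0, \dots, S_{m}\}$. For each $1 \le i \le v$ let $Z_i = x_1\bar{x}_1 \ldots x_{i-1}\bar{x}_{i-1} x_{i+1}\bar{x}_{i+1}\ldots x_{v}\bar{x}_{v}$ (i.e., $S_0$ with the pair $x_i\bar x_i$ removed), and $\mathcal Z(\phi) = \{Z_1, \ldots, Z_{v}\}$. -}

module Defs where

open import Data.Nat using (ℕ; suc; _∸_)
open import Data.Fin using (Fin; toℕ; _<_)
open import Data.Fin.Properties using (_≟_)
open import Data.Bool using (Bool; true; false; if_then_else_)
open import Data.Product using (_×_; _,_)
open import Data.List using (List; []; _∷_; _++_; concat; concatMap; replicate; reverse; allFin; map)
open import Data.List.Membership.Propositional using (_∈_)
open import Data.List.Relation.Binary.Sublist.Propositional using (_⊆_)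
open import Relation.Binary.PropositionalEquality using (_≡_; _≢_)
open import Relation.Nullary using (¬_)
open import Relation.Nullary.Decidable using (⌊_⌋)

-- Variables x_1 … x_v are represented by Fin v (index j stands for x_{j+1}).
-- A literal / character: (j , true) = x_{j+1},  (j , false) = x̄_{j+1}.
Lit : ℕ → Set
Lit v = Fin v × Bool

Str : ℕ → Set
Str v = List (Lit v)

_≼_ : ∀ {v} → Str v → Str v → Set
Y ≼ X = Y ⊆ X

IsCommonSubseq : ∀ {v} → List (Str v) → Str v → Set
IsCommonSubseq 𝒮 X = ∀ S → S ∈ 𝒮 → X ≼ S

IsMCS : ∀ {v} → List (Str v) → Str v → Set
IsMCS {v} 𝒮 X = IsCommonSubseq 𝒮 X ×
  (∀ (Y : Str v) → X ≼ Y → X ≢ Y → ¬ IsCommonSubseq 𝒮 Y)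

-- A 3-CNF clause ℓ₁ ∨ ℓ₂ ∨ ℓ₃ on variables α < β < γ
-- (pol = true: positive literal x, pol = false: negated literal x̄).
-- Distinct variables, so no clause contains both x_j and x̄_j.
record Clause (v : ℕ) : Set where
  field
    α β γ : Fin v
    α<β : α < β
    β<γ : β < γ
    p₁ p₂ p₃ : Bool
open Clause public

Occurs : ∀ {v} → Fin v → Clause v → Set
Occurs j C = j ∈ (α C ∷ β C ∷ γ C ∷ [])

pair : ∀ {v} → Fin v → Str v
pair j = (j , true) ∷ (j , false) ∷ []

R : (v : ℕ) → Str v
R v = concatMap pair (reverse (allFin v))

pow : ∀ {v} → Str v → ℕ → Str v
pow X k = concat (replicate k X)

S₀ : (v : ℕ) → Str v
S₀ v = concatMap pair (allFin v)

-- S_i = R^{α-1} ℓ₁ R^{β-α} ℓ₂ R^{γ-β} ℓ₃ R^{v-γ}   (α,β,γ 1-based in the paper;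
-- here toℕ α = α_paper - 1 etc.)
Sᶜ : ∀ {v} → Clause v → Str v
Sᶜ {v} C =
  pow (R v) (toℕ (α C)) ++ ((α C , p₁ C) ∷
  pow (R v) (toℕ (β C) ∸ toℕ (α C)) ++ ((β C , p₂ C) ∷
  pow (R v) (toℕ (γ C) ∸ toℕ (β C)) ++ ((γ C , p₃ C) ∷
  pow (R v) (v ∸ suc (toℕ (γ C))))))

𝒮 : ∀ {v} → List (Clause v) → List (Str v)
𝒮 {v} φ = S₀ v ∷ map Sᶜ φ

Z : ∀ {v} → Fin v → Str v
Z {v} i = concatMap (λ j → if ⌊ j ≟ i ⌋ then [] else pair j) (allFin v)

{-# OPTIONS --safe #-}
module Submission where

-- Z i is a common subsequence: it consists of v − 1 pairs x_j x̄_j, each a subsequence of R, and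
-- deleting the three literals of S_C leaves R^(v−1).
--
-- For maximality, a common supersequence Y ≠ Z i must contain a letter (i , b). Pick a clause C
-- avoiding x_i and an assignment s falsifying C with s i = b, and let G be the letters of Y that are
-- true under s. As a subsequence of S₀ with one letter per variable, G is strictly increasing in the
-- variable index; as it avoids the literals of C, it is a subsequence of R^(v−1). Since R is
-- non-increasing in the variable index, each copy of R holds at most one letter of G, so |G| ≤ v − 1.
-- But G contains (i , b) and one letter of every other variable (from Z i), so |G| ≥ v.

open import Defs
open import Data.Nat using (ℕ; zero; suc; _+_; _∸_; _≤_; _<_; z≤n; s≤s)
open import Data.Nat.Properties using (+-assoc; m+[n∸m]≡n; suc-injective; <⇒≤; <⇒≱)
open import Data.Fin as Fin using (Fin; toℕ)
open import Data.Fin.Properties using (_≟_; toℕ<n; <-irrefl; <-asym; <-trans; <⇒≢)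
open import Data.Bool using (Bool; true; false; not; if_then_else_)
import Data.Bool.Properties as Bool
open import Data.Empty using (⊥-elim)
open import Data.Product using (∃; _×_; _,_; proj₁; proj₂)
open import Function using (id; _∘_; _on_; flip; const)
open import Data.List using (List; []; _∷_; _++_; concat; concatMap; replicate; reverse; allFin; map; filter; length)
open import Data.List.Properties using (++-assoc; unfold-reverse; filter-accept; filter-reject; filter-all; length-map; length-tabulate)
open import Data.List.Membership.Propositional using (_∈_; _∉_; find)
open import Data.List.Membership.Propositional.Properties using (∈-map⁺; ∈-map⁻; ∈-filter⁺; ∈-filter⁻; ∈-allFin)
open import Data.List.Relation.Unary.Any using (here; there; any?)
import Data.List.Relation.Unary.Any.Properties as Any
open import Data.List.Relation.Unary.All as All using (All; []; _∷_)
open import Data.List.Relation.Unary.All.Properties using (¬Any⇒All¬; ¬All⇒Any¬; all-filter)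
open import Data.List.Relation.Unary.AllPairs as AllPairs using (AllPairs; []; _∷_)
import Data.List.Relation.Unary.AllPairs.Properties as AllPairsₚ
open import Data.List.Relation.Unary.Unique.Propositional using (Unique)
open import Data.List.Relation.Unary.Unique.Propositional.Properties using (allFin⁺)
open import Data.List.Relation.Binary.Sublist.Propositional using (_⊆_; []; _∷_; _∷ʳ_; ⊆-refl; ⊆-trans; ⊆-antisym)
open import Data.List.Relation.Binary.Sublist.Propositional.Properties
  using (++⁺; ++⁺ˡ; ++⁺ʳ; ∷ˡ⁻; filter⁺; filter-⊆; length-mono-≤; All-resp-⊆)
open import Data.Vec.Functional using (updateAt)
open import Data.Vec.Functional.Properties using (updateAt-updates; updateAt-minimal)
open import Relation.Binary.Definitions using (DecidableEquality)
open import Relation.Binary.PropositionalEquality using (_≡_; _≢_; refl; sym; trans; cong; subst; subst₂; module ≡-Reasoning)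
open import Relation.Nullary using (¬_; Dec; yes; no; ¬?)
open import Relation.Nullary.Decidable using (⌊_⌋)
open import Relation.Unary using (Decidable)

module _ {A : Set} where

  AllPairs-resp-⊆ : ∀ {_~_ : A → A → Set} {xs ys} → xs ⊆ ys → AllPairs _~_ ys → AllPairs _~_ xs
  AllPairs-resp-⊆ []         []       = []
  AllPairs-resp-⊆ (_ ∷ʳ τ)   (_ ∷ ps) = AllPairs-resp-⊆ τ ps
  AllPairs-resp-⊆ (refl ∷ τ) (p ∷ ps) = All-resp-⊆ τ p ∷ AllPairs-resp-⊆ τ ps

  AllPairs-reverse⁺ : ∀ {_~_ : A → A → Set} {xs} → AllPairs _~_ xs → AllPairs (flip _~_) (reverse xs)
  AllPairs-reverse⁺ {xs = []}     []       = []
  AllPairs-reverse⁺ {xs = x ∷ xs} (p ∷ ps) rewrite unfold-reverse x xs =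
    AllPairsₚ.++⁺ (AllPairs-reverse⁺ ps) ([] ∷ [])
      (All.tabulate (λ y∈ → All.lookup p (Any.reverse⁻ y∈) ∷ []))

  length-<-⊆ : ∀ {x : A} {xs ys} → xs ⊆ ys → x ∈ ys → x ∉ xs → length xs < length ys
  length-<-⊆ (_ ∷ʳ τ)   _            _   = s≤s (length-mono-≤ τ)
  length-<-⊆ (refl ∷ τ) (here refl) x∉xs = ⊥-elim (x∉xs (here refl))
  length-<-⊆ (refl ∷ τ) (there x∈)  x∉xs = s≤s (length-<-⊆ τ x∈ (x∉xs ∘ there))

  -- The continuation for the suffix B lets the three literals of S_C be erased in one nested call.
  ⊆-++-∷-erase : ∀ {P : A → Set} {ℓ B B′} → ¬ P ℓ → (∀ {H} → All P H → H ⊆ B → H ⊆ B′) →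
                 ∀ C {G} → All P G → G ⊆ C ++ ℓ ∷ B → G ⊆ C ++ B′
  ⊆-++-∷-erase ¬Pℓ edit []      PG       (_ ∷ʳ τ)   = edit PG τ
  ⊆-++-∷-erase ¬Pℓ edit []      (Pℓ ∷ _) (refl ∷ τ) = ⊥-elim (¬Pℓ Pℓ)
  ⊆-++-∷-erase ¬Pℓ edit (c ∷ C) PG       (_ ∷ʳ τ)   = c ∷ʳ ⊆-++-∷-erase ¬Pℓ edit C PG τ
  ⊆-++-∷-erase ¬Pℓ edit (c ∷ C) (_ ∷ PG) (refl ∷ τ) = refl ∷ ⊆-++-∷-erase ¬Pℓ edit C PG τ

module _ {A : Set} (_≟ᴬ_ : DecidableEquality A) (x : A) where

  private
    ≢x? : Decidable (_≢ x)
    ≢x? y = ¬? (y ≟ᴬ x)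

  length-filter-≢ : ∀ {xs} → Unique xs → x ∈ xs → suc (length (filter ≢x? xs)) ≡ length xs
  length-filter-≢ (x∉ys ∷ _) (here refl) = cong (suc ∘ length)
    (trans (filter-reject ≢x? (λ x≢x → x≢x refl)) (filter-all ≢x? (All.map (_∘ sym) x∉ys)))
  length-filter-≢ (y∉ys ∷ u) (there x∈ys) =
    cong suc (trans (cong length (filter-accept ≢x? (All.lookup y∉ys x∈ys))) (length-filter-≢ u x∈ys))

-- A word strictly increasing for ≺ meets each copy of a block without ≺-ascents at most once.
module _ {A : Set} (_≺_ : A → A → Set) where

  ⊆-++-skip : ∀ {x} D {G T} → All (λ y → ¬ x ≺ y) D → All (x ≺_) G → G ⊆ D ++ T → G ⊆ T
  ⊆-++-skip []      _          _         τ          = τ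
  ⊆-++-skip (_ ∷ D) (_ ∷ ¬x≺D) x≺G       (_ ∷ʳ τ)   = ⊆-++-skip D ¬x≺D x≺G τ
  ⊆-++-skip (_ ∷ D) (¬x≺y ∷ _) (x≺y ∷ _) (refl ∷ τ) = ⊥-elim (¬x≺y x≺y)

  ∷-⊆-++⁻ : ∀ D {x G T} → AllPairs (λ y z → ¬ y ≺ z) D → All (x ≺_) G → x ∷ G ⊆ D ++ T → G ⊆ T
  ∷-⊆-++⁻ []      _          _   τ          = ∷ˡ⁻ τ
  ∷-⊆-++⁻ (_ ∷ D) (_ ∷ D↓)   x≺G (_ ∷ʳ τ)   = ∷-⊆-++⁻ D D↓ x≺G τ
  ∷-⊆-++⁻ (_ ∷ D) (¬x≺D ∷ _) x≺G (refl ∷ τ) = ⊆-++-skip D ¬x≺D x≺G τ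

  length-≤-concat-replicate : ∀ D → AllPairs (λ y z → ¬ y ≺ z) D →
                              ∀ k {G} → AllPairs _≺_ G → G ⊆ concat (replicate k D) → length G ≤ k
  length-≤-concat-replicate D D↓ zero    []         [] = z≤n
  length-≤-concat-replicate D D↓ (suc k) []         _  = z≤n
  length-≤-concat-replicate D D↓ (suc k) (x≺G ∷ G↑) τ  =
    s≤s (length-≤-concat-replicate D D↓ k G↑ (∷-⊆-++⁻ D D↓ x≺G τ))

pow-+ : ∀ {v} (X : Str v) m n → pow X (m + n) ≡ pow X m ++ pow X n
pow-+ X zero    n = refl
pow-+ X (suc m) n = trans (cong (X ++_) (pow-+ X m n)) (sym (++-assoc X (pow X m) (pow X n)))

module _ {v : ℕ} where

  _≺_ : Lit v → Lit v → Set
  _≺_ = Fin._<_ on proj₁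

  _⊨_ : (Fin v → Bool) → Lit v → Set
  s ⊨ ℓ = proj₂ ℓ ≡ s (proj₁ ℓ)

  _⊨?_ : (s : Fin v → Bool) → Decidable (s ⊨_)
  s ⊨? ℓ = proj₂ ℓ Bool.≟ s (proj₁ ℓ)

  Falsifies : (Fin v → Bool) → Clause v → Set
  Falsifies s C = ¬ s ⊨ (α C , p₁ C) × ¬ s ⊨ (β C , p₂ C) × ¬ s ⊨ (γ C , p₃ C)

  falsifying-assignment : ∀ {i} (C : Clause v) → ¬ Occurs i C → (b : Bool) →
                          ∃ λ s → s i ≡ b × Falsifies s C
  falsifying-assignment {i} C i∉C b = s , s-i , falsified s-α , falsified s-β , falsified s-γ
    where
    s₁ s₂ s : Fin v → Bool
    s₁ = updateAt (const b) (α C) (const (not (p₁ C)))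
    s₂ = updateAt s₁ (β C) (const (not (p₂ C)))
    s  = updateAt s₂ (γ C) (const (not (p₃ C)))

    falsified : ∀ {j p} → s j ≡ not p → ¬ s ⊨ (j , p)
    falsified sj≡¬p p≡sj = Bool.not-¬ refl (trans p≡sj sj≡¬p)

    α≢β : α C ≢ β C
    α≢β = <⇒≢ (α<β C)
    α≢γ : α C ≢ γ C
    α≢γ = <⇒≢ (<-trans (α<β C) (β<γ C))
    β≢γ : β C ≢ γ C
    β≢γ = <⇒≢ (β<γ C)

    s-i : s i ≡ b
    s-i = trans (updateAt-minimal i (γ C) s₂ (i∉C ∘ there ∘ there ∘ here))
            (trans (updateAt-minimal i (β C) s₁ (i∉C ∘ there ∘ here))
              (updateAt-minimal i (α C) (const b) (i∉C ∘ here)))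
    s-α : s (α C) ≡ not (p₁ C)
    s-α = trans (updateAt-minimal (α C) (γ C) s₂ α≢γ)
            (trans (updateAt-minimal (α C) (β C) s₁ α≢β) (updateAt-updates (α C) (const b)))
    s-β : s (β C) ≡ not (p₂ C)
    s-β = trans (updateAt-minimal (β C) (γ C) s₂ β≢γ) (updateAt-updates (β C) s₁)
    s-γ : s (γ C) ≡ not (p₃ C)
    s-γ = updateAt-updates (γ C) s₂

  All-concatMap-pair : ∀ {P : Fin v → Set} {xs} → All P xs → All (P ∘ proj₁) (concatMap pair xs)
  All-concatMap-pair []       = []
  All-concatMap-pair (p ∷ ps) = p ∷ p ∷ All-concatMap-pair ps

  AllPairs-concatMap-pair : ∀ {r : Fin v → Fin v → Set} → (∀ {j} → r j j) →
                            ∀ {xs} → AllPairs r xs → AllPairs (r on proj₁) (concatMap pair xs)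
  AllPairs-concatMap-pair r-refl []       = []
  AllPairs-concatMap-pair r-refl (p ∷ ps) =
    (r-refl ∷ All-concatMap-pair p) ∷ All-concatMap-pair p ∷ AllPairs-concatMap-pair r-refl ps

  R-nonincreasing : AllPairs (λ x y → ¬ x ≺ y) (R v)
  R-nonincreasing = AllPairs-concatMap-pair (<-irrefl refl)
    (AllPairs.map <-asym (AllPairs-reverse⁺ (AllPairsₚ.tabulate⁺-< id)))

  pair-⊆-concatMap : ∀ {j : Fin v} {xs} → j ∈ xs → pair j ⊆ concatMap pair xs
  pair-⊆-concatMap {xs = _ ∷ xs} (here refl) = ++⁺ʳ (concatMap pair xs) ⊆-refl
  pair-⊆-concatMap {xs = k ∷ _}  (there j∈) = ++⁺ˡ (pair k) (pair-⊆-concatMap j∈)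

  concatMap-pair-⊆-pow-R : ∀ xs → concatMap pair xs ⊆ pow (R v) (length xs)
  concatMap-pair-⊆-pow-R []       = []
  concatMap-pair-⊆-pow-R (j ∷ xs) =
    ++⁺ (pair-⊆-concatMap (Any.reverse⁺ (∈-allFin j))) (concatMap-pair-⊆-pow-R xs)

  filter-var-concatMap-pair : ∀ {P : Fin v → Set} (P? : Decidable P) xs →
                              filter (P? ∘ proj₁) (concatMap pair xs) ≡ concatMap pair (filter P? xs)
  filter-var-concatMap-pair P? []       = refl
  filter-var-concatMap-pair P? (j ∷ xs) with P? j
  ... | yes Pj = cong ((j , true) ∷_)
    (trans (filter-accept (P? ∘ proj₁) Pj) (cong ((j , false) ∷_) (filter-var-concatMap-pair P? xs)))
  ... | no ¬Pj = trans (filter-reject (P? ∘ proj₁) ¬Pj) (filter-var-concatMap-pair P? xs)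

  filter-⊨-concatMap-pair : ∀ s xs → filter (s ⊨?_) (concatMap pair xs) ≡ map (λ j → j , s j) xs
  filter-⊨-concatMap-pair s []       = refl
  filter-⊨-concatMap-pair s (j ∷ xs) with s j in sj
  ... | true  = cong ((j , true) ∷_)
    (trans (filter-reject (s ⊨?_) (Bool.not-¬ sj ∘ sym)) (filter-⊨-concatMap-pair s xs))
  ... | false = trans (filter-accept (s ⊨?_) (sym sj)) (cong ((j , false) ∷_) (filter-⊨-concatMap-pair s xs))

  filter-⊨-ascending : ∀ s {Y} → Y ⊆ S₀ v → AllPairs _≺_ (filter (s ⊨?_) Y)
  filter-⊨-ascending s Y⊆S₀ =
    AllPairs-resp-⊆ (filter⁺ (s ⊨?_) (s ⊨?_) (subst (s ⊨_)) Y⊆S₀)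
      (subst (AllPairs _≺_) (sym (filter-⊨-concatMap-pair s (allFin v)))
        (AllPairsₚ.map⁺ (AllPairsₚ.tabulate⁺-< id)))

  module _ (C : Clause v) where
    private
      e₁ e₂ e₃ e₄ : ℕ
      e₁ = toℕ (α C)
      e₂ = toℕ (β C) ∸ toℕ (α C)
      e₃ = toℕ (γ C) ∸ toℕ (β C)
      e₄ = v ∸ suc (toℕ (γ C))

      Rᵉ : ℕ → Str v
      Rᵉ = pow (R v)

    R-count : ℕ
    R-count = e₁ + (e₂ + (e₃ + e₄))

    suc-R-count : suc R-count ≡ v
    suc-R-count = begin
      suc (e₁ + (e₂ + (e₃ + e₄)))     ≡⟨ cong suc (sym (+-assoc e₁ e₂ _)) ⟩
      suc (e₁ + e₂ + (e₃ + e₄))       ≡⟨ cong (λ n → suc (n + (e₃ + e₄))) (m+[n∸m]≡n (<⇒≤ (α<β C))) ⟩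
      suc (toℕ (β C) + (e₃ + e₄))     ≡⟨ cong suc (sym (+-assoc (toℕ (β C)) e₃ e₄)) ⟩
      suc (toℕ (β C) + e₃ + e₄)       ≡⟨ cong (λ n → suc (n + e₄)) (m+[n∸m]≡n (<⇒≤ (β<γ C))) ⟩
      suc (toℕ (γ C)) + e₄            ≡⟨ m+[n∸m]≡n (toℕ<n (γ C)) ⟩
      v                               ∎
      where open ≡-Reasoning

    pow-R-count-split : Rᵉ R-count ≡ Rᵉ e₁ ++ (Rᵉ e₂ ++ (Rᵉ e₃ ++ Rᵉ e₄))
    pow-R-count-split = trans (pow-+ (R v) e₁ _)
      (cong (Rᵉ e₁ ++_) (trans (pow-+ (R v) e₂ _) (cong (Rᵉ e₂ ++_) (pow-+ (R v) e₃ e₄))))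

    pow-R-count-⊆-Sᶜ : Rᵉ R-count ⊆ Sᶜ C
    pow-R-count-⊆-Sᶜ = subst (_⊆ Sᶜ C) (sym pow-R-count-split)
      (++⁺ ⊆-refl (_ ∷ʳ ++⁺ ⊆-refl (_ ∷ʳ ++⁺ ⊆-refl (_ ∷ʳ ⊆-refl))))

    ⊆-Sᶜ⇒⊆-pow-R-count : ∀ {s G} → Falsifies s C → All (s ⊨_) G → G ⊆ Sᶜ C → G ⊆ Rᵉ R-count
    ⊆-Sᶜ⇒⊆-pow-R-count {G = G} (¬ℓ₁ , ¬ℓ₂ , ¬ℓ₃) sG τ = subst (G ⊆_) (sym pow-R-count-split)
      (⊆-++-∷-erase ¬ℓ₁ (⊆-++-∷-erase ¬ℓ₂ (⊆-++-∷-erase ¬ℓ₃ (λ _ → id) (Rᵉ e₃)) (Rᵉ e₂)) (Rᵉ e₁) sG τ)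

  ascending-true-⊆-Sᶜ⇒length<v : ∀ {s C G} → Falsifies s C → AllPairs _≺_ G → All (s ⊨_) G → G ⊆ Sᶜ C →
                                 length G < v
  ascending-true-⊆-Sᶜ⇒length<v {C = C} {G} s-falsifies G↑ sG G⊆Sᶜ = subst (length G <_) (suc-R-count C)
    (s≤s (length-≤-concat-replicate _≺_ (R v) R-nonincreasing (R-count C) G↑
           (⊆-Sᶜ⇒⊆-pow-R-count C s-falsifies sG G⊆Sᶜ)))

  module _ (i : Fin v) where

    others : List (Fin v)
    others = filter (λ j → ¬? (j ≟ i)) (allFin v)

    suc-length-others : suc (length others) ≡ v
    suc-length-others = trans (length-filter-≢ _≟_ i (allFin⁺ v) (∈-allFin i)) (length-tabulate id)

    Z-pairs : Z i ≡ concatMap pair others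
    Z-pairs = go (allFin v)
      where
      go : ∀ xs → concatMap (λ j → if ⌊ j ≟ i ⌋ then [] else pair j) xs
                ≡ concatMap pair (filter (λ j → ¬? (j ≟ i)) xs)
      go []       = refl
      go (j ∷ xs) with j ≟ i
      ... | yes _ = go xs
      ... | no  _ = cong (pair j ++_) (go xs)

    var≢? : (x : Lit v) → Dec (proj₁ x ≢ i)
    var≢? x = ¬? (proj₁ x ≟ i)

    Z-filter : Z i ≡ filter var≢? (S₀ v)
    Z-filter = trans Z-pairs (sym (filter-var-concatMap-pair (λ j → ¬? (j ≟ i)) (allFin v)))

    Z-⊆-S₀ : Z i ⊆ S₀ v
    Z-⊆-S₀ = subst (_⊆ S₀ v) (sym Z-filter) (filter-⊆ var≢? (S₀ v))

    Z-⊆-Sᶜ : ∀ C → Z i ⊆ Sᶜ C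
    Z-⊆-Sᶜ C = subst (_⊆ Sᶜ C) (sym Z-pairs)
      (⊆-trans (concatMap-pair-⊆-pow-R others)
        (subst (λ n → pow (R v) n ⊆ Sᶜ C) (sym length-others≡R-count) (pow-R-count-⊆-Sᶜ C)))
      where
      length-others≡R-count : length others ≡ R-count C
      length-others≡R-count = suc-injective (trans suc-length-others (sym (suc-R-count C)))

    ∉-Z : ∀ {b} → (i , b) ∉ Z i
    ∉-Z i∈Z = proj₂ (∈-filter⁻ var≢? {xs = S₀ v} (subst ((i , _) ∈_) Z-filter i∈Z)) refl

    ⊆-Z : ∀ {Y} → All (λ x → proj₁ x ≢ i) Y → Y ⊆ S₀ v → Y ⊆ Z i
    ⊆-Z Y-avoids Y⊆S₀ =
      subst₂ _⊆_ (filter-all var≢? Y-avoids) (sym Z-filter)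
        (filter⁺ var≢? var≢? (subst (λ x → proj₁ x ≢ i)) Y⊆S₀)

    Z-supersequence⇒v≤length-true : ∀ {s b Y} → s i ≡ b → (i , b) ∈ Y → Z i ⊆ Y →
                                    v ≤ length (filter (s ⊨?_) Y)
    Z-supersequence⇒v≤length-true {s} {b} {Y} si≡b i∈Y Z⊆Y =
      subst (_≤ length (filter (s ⊨?_) Y)) length-X
        (length-<-⊆ (filter⁺ (s ⊨?_) (s ⊨?_) (subst (s ⊨_)) Z⊆Y)
                    (∈-filter⁺ (s ⊨?_) i∈Y (sym si≡b))
                    (λ i∈X → ∉-Z (proj₁ (∈-filter⁻ (s ⊨?_) {xs = Z i} i∈X))))
      where
      length-X : suc (length (filter (s ⊨?_) (Z i))) ≡ v
      length-X = begin
        suc (length (filter (s ⊨?_) (Z i)))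
          ≡⟨ cong (suc ∘ length ∘ filter (s ⊨?_)) Z-pairs ⟩
        suc (length (filter (s ⊨?_) (concatMap pair others)))
          ≡⟨ cong (suc ∘ length) (filter-⊨-concatMap-pair s others) ⟩
        suc (length (map (λ j → j , s j) others))
          ≡⟨ cong suc (length-map _ others) ⟩
        suc (length others)
          ≡⟨ suc-length-others ⟩
        v ∎
        where open ≡-Reasoning

  Z-supersequence-with-i-⊈-Sᶜ : ∀ {i C b Y} → ¬ Occurs i C → (i , b) ∈ Y → Z i ⊆ Y → Y ⊆ S₀ v →
                                ¬ Y ⊆ Sᶜ C
  Z-supersequence-with-i-⊈-Sᶜ {i} {C} {b} {Y} i∉C i∈Y Z⊆Y Y⊆S₀ Y⊆Sᶜ
    with falsifying-assignment C i∉C b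
  ... | s , si≡b , s-falsifies =
    <⇒≱ (ascending-true-⊆-Sᶜ⇒length<v {s} {C} s-falsifies (filter-⊨-ascending s Y⊆S₀)
           (all-filter (s ⊨?_) Y) (⊆-trans (filter-⊆ (s ⊨?_) Y) Y⊆Sᶜ))
        (Z-supersequence⇒v≤length-true i {s} si≡b i∈Y Z⊆Y)

  Z-maximal-in-S₀-Sᶜ : ∀ {i C Y} → ¬ Occurs i C → Z i ⊆ Y → Z i ≢ Y → Y ⊆ S₀ v → ¬ Y ⊆ Sᶜ C
  Z-maximal-in-S₀-Sᶜ {i} {C} {Y} i∉C Z⊆Y Z≢Y Y⊆S₀ with any? (λ x → proj₁ x ≟ i) Y
  ... | no ¬var-i = λ _ → Z≢Y (⊆-antisym Z⊆Y (⊆-Z i (¬Any⇒All¬ Y ¬var-i) Y⊆S₀))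
  ... | yes var-i with find var-i
  ...   | (_ , b) , i∈Y , refl = Z-supersequence-with-i-⊈-Sᶜ {C = C} i∉C i∈Y Z⊆Y Y⊆S₀

clause-avoiding : ∀ {v} {φ : List (Clause v)} {i} → ¬ (∀ C → C ∈ φ → Occurs i C) →
                  ∃ λ C → C ∈ φ × ¬ Occurs i C
clause-avoiding {φ = φ} {i} ¬all-occur =
  find (¬All⇒Any¬ (λ C → any? (i ≟_) (α C ∷ β C ∷ γ C ∷ [])) φ
                  (λ all → ¬all-occur (λ _ → All.lookup all)))

lemma1 : (v : ℕ) (φ : List (Clause v)) →
    (∀ (j : Fin v) → ¬ (∀ C → C ∈ φ → Occurs j C)) →
    ∀ (i : Fin v) → IsMCS (𝒮 φ) (Z i)
lemma1 v φ no-universal-variable i = Z-common , Z-maximal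
  where
  Z-common : IsCommonSubseq (𝒮 φ) (Z i)
  Z-common _ (here refl) = Z-⊆-S₀ i
  Z-common _ (there S∈) with ∈-map⁻ Sᶜ S∈
  ... | C , _ , refl = Z-⊆-Sᶜ i C

  Z-maximal : ∀ Y → Z i ≼ Y → Z i ≢ Y → ¬ IsCommonSubseq (𝒮 φ) Y
  Z-maximal Y Z⊆Y Z≢Y Y-common =
    let C , C∈φ , i∉C = clause-avoiding (no-universal-variable i)
    in Z-maximal-in-S₀-Sᶜ {C = C} i∉C Z⊆Y Z≢Y
         (Y-common _ (here refl)) (Y-common _ (there (∈-map⁺ Sᶜ C∈φ)))
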